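{- Let $n\in\mathbb{N}^\ast$, and let $\boldsymbol{\mathcal{A}}$, $\rho$, $T$ be as in the context. For every $\mathbf{a}\in\boldsymbol{\mathcal{A}}$, the matrix $T\rho(\mathbf{a})$ is symmetric.
   Context: Fix $n\in\mathbb{N}^\ast$ and define $i\,\mathcal{R}\,j\iff\lfloor n/i\rfloor=\lfloor n/j\rfloor$ on $\mathbb{N}^\ast$; its classes are intervals, the integers $>n$ form the only unbounded class. $\mathcal{S}$ is the set of largest elements of the bounded classes, $s=\#\mathcal{S}$, and $\mathcal{S}=\{s_1<\dots<s_s\}$. $\boldsymbol{\mathcal{A}}$ is the free $\mathbb{Z}$-module with basis $\{\mathbf{k}:k\in\mathcal{S}\}$, made into a commutative $\mathbb{Z}$-algebra by the bilinear multiplication: $\mathbf{i}\mathbf{j}=\mathbf{l}$ if $ij\le n$, where $l\in\mathcal{S}$ is the largest element of the class of $ij$, and $\mathbf{i}\mathbf{j}=0$ if $ij>n$. For $\mathbf{a}\in\boldsymbol{\mathcal{A}}$, $\rho(\mathbf{a})$ is the $s\times s$ matrix, rows and columns indexed by $\mathcal{S}$ in increasing order, of the linear map $\mathbf{x}\mapsto\mathbf{a}\mathbf{x}$ in the basis $(\mathbf{k})_{k\in\mathcal{S}}$. $T$ is the $s\times s$ matrix with $T_{s_p,s_q}=1$ if $p+q\le s+1$ and $0$ otherwise. -}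

module Defs where

open import Data.Nat using (ℕ; zero; suc; _+_; _*_; _≤_; _<_; _≤?_; _≟_)
open import Data.Nat.DivMod using (_/_)
open import Data.Fin using (Fin; toℕ)
open import Data.List using (List; []; _∷_; length; lookup; filter; upTo; map)
open import Data.Integer using (ℤ; 0ℤ; 1ℤ) renaming (_+_ to _+ℤ_; _*_ to _*ℤ_)
open import Relation.Nullary using (yes; no; Dec)
open import Relation.Nullary.Decidable using (⌊_⌋)
open import Data.Bool using (Bool; true; false; if_then_else_)

-- ⌊ n / j ⌋ for j ∈ ℕ* (the value at j = 0 is never used)
fl : ℕ → ℕ → ℕ
fl n zero    = 0
fl n (suc j) = n / suc j

R : ℕ → ℕ → ℕ → Set
R n i j = fl n i ≡ fl n j
  where open import Relation.Binary.PropositionalEquality using (_≡_)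

-- For 1 ≤ m ≤ n, the class of m is bounded and contained in [1, n]
-- (integers > n have ⌊n/j⌋ = 0 ≠ ⌊n/m⌋).  `largestIn n m k` is the largest
-- j ∈ [1, k] with j R m (or 0 if none); `largest n m = largestIn n m n` is
-- the largest element of the class of m.
largestIn : ℕ → ℕ → ℕ → ℕ
largestIn n m zero    = 0
largestIn n m (suc k) with fl n (suc k) ≟ fl n m
... | yes _ = suc k
... | no  _ = largestIn n m k

largest : ℕ → ℕ → ℕ
largest n m = largestIn n m n

-- 𝒮 = set of largest elements of bounded classes, listed in increasing order
-- (elements of [1, n] that are the largest element of their own class).
𝒮 : ℕ → List ℕ
𝒮 n = filter (λ k → largest n k ≟ k) (map suc (upTo n))

s : ℕ → ℕ
s n = length (𝒮 n)

-- s_p for p ∈ Fin (s n)  (0-based index: s_{p+1} in the paper's notation)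
sₚ : (n : ℕ) → Fin (s n) → ℕ
sₚ n p = lookup (𝒮 n) p

sumFin : (m : ℕ) → (Fin m → ℤ) → ℤ
sumFin zero    f = 0ℤ
sumFin (suc m) f = f Fin.zero +ℤ sumFin m (λ i → f (Fin.suc i))
  where import Data.Fin as Fin

-- elements of 𝓐 = free ℤ-module on {𝐤 : k ∈ 𝒮}, as coefficient vectors
𝓐 : ℕ → Set
𝓐 n = Fin (s n) → ℤ

basis : (n : ℕ) → Fin (s n) → 𝓐 n
basis n q p = if ⌊ toℕ p ≟ toℕ q ⌋ then 1ℤ else 0ℤ

basisMul : (n : ℕ) → Fin (s n) → Fin (s n) → 𝓐 n
basisMul n i j p =
  if ⌊ sₚ n i * sₚ n j ≤? n ⌋
  then (if ⌊ sₚ n p ≟ largest n (sₚ n i * sₚ n j) ⌋ then 1ℤ else 0ℤ)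
  else 0ℤ

mul : (n : ℕ) → 𝓐 n → 𝓐 n → 𝓐 n
mul n x y p = sumFin (s n) (λ i → sumFin (s n) (λ j → (x i *ℤ y j) *ℤ basisMul n i j p))

Mat : ℕ → Set
Mat n = Fin (s n) → Fin (s n) → ℤ

ρ : (n : ℕ) → 𝓐 n → Mat n
ρ n a p q = mul n a (basis n q) p

T : (n : ℕ) → Mat n
T n p q = if ⌊ (suc (toℕ p) + suc (toℕ q)) ≤? suc (s n) ⌋ then 1ℤ else 0ℤ

matMul : (n : ℕ) → Mat n → Mat n → Mat n
matMul n A B p q = sumFin (s n) (λ r → A p r *ℤ B r q)

Symmetric : (n : ℕ) → Mat n → Set
Symmetric n M = ∀ p q → M p q ≡ M q p
  where open import Relation.Binary.PropositionalEquality using (_≡_)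

{-# OPTIONS --safe #-}
-- The (p, q) entry of T ρ(a) is Σᵢ aᵢ [s_p s_i s_q ≤ n], which is symmetric in p and q.
-- Two facts give this.  First, x ↦ ⌊n/x⌋ maps 𝒮 into itself and reverses its order, so it
-- sends s_p to s_{s+1-p}; hence T_{p,t} = 1 iff s_t ≤ ⌊n/s_p⌋, i.e. iff s_p s_t ≤ n.
-- Second, whether y m ≤ n holds depends only on ⌊n/m⌋, i.e. only on the class of m, so
-- the product 𝐢𝐪 = 𝐥 may be replaced by s_i s_q itself.
module Submission where

open import Defs
open import Data.Nat using (ℕ; zero; suc; >-nonZero; _+_; _∸_; _*_; _≤_; _<_; _≤?_; _≟_; s≤s; z≤n)
import Data.Nat.Properties as ℕ
open import Data.Nat.DivMod using (m*n/n≡m; m/n*n≤m; m/n≤m; /-monoˡ-≤; /-monoʳ-≤)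
open import Data.Fin as Fin using (Fin; zero; suc; toℕ; fromℕ<)
import Data.Fin.Properties as Fin
open import Data.Integer using (ℤ; 0ℤ; 1ℤ) renaming (_+_ to _+ℤ_; _*_ to _*ℤ_)
import Data.Integer.Properties as ℤ
open import Algebra.Properties.Semiring.Sum ℤ.+-*-semiring
  using (sum; sum-cong-≗; sum-replicate-zero; ∑-comm; *-distribˡ-sum)
open import Algebra.Properties.CommutativeSemigroup ℕ.*-commutativeSemigroup
  using () renaming (x∙yz≈z∙yx to x*[y*z]≡z*[y*x])
open import Algebra.Properties.CommutativeSemigroup ℤ.*-commutativeSemigroup
  using () renaming (xy∙z≈xz∙y to xy*z≡xz*y; x∙yz≈y∙xz to x*[y*z]≡y*[x*z])
open import Data.List using (List; lookup; upTo; map)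
open import Data.List.Membership.Propositional using (_∈_)
open import Data.List.Membership.Propositional.Properties
  using (∈-filter⁻; ∈-filter⁺; ∈-map⁻; ∈-map⁺; ∈-upTo⁻; ∈-upTo⁺; ∈-lookup)
open import Data.List.Relation.Unary.Any using (index)
open import Data.List.Relation.Unary.Any.Properties using (lookup-index)
import Data.List.Relation.Unary.All as All
open import Data.List.Relation.Unary.AllPairs using (AllPairs; _∷_)
import Data.List.Relation.Unary.AllPairs.Properties as AllPairs
open import Data.Bool using (if_then_else_)
open import Data.Product using (_,_)
open import Data.Sum using (inj₁; inj₂)
open import Data.Empty using (⊥-elim)
open import Function using (_∘_; id; _⇔_; mk⇔; Equivalence)
open import Function.Properties.Equivalence using (⇔-setoid)
open import Relation.Binary.Core using (Rel; _Preserves_⟶_)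
open import Relation.Binary.PropositionalEquality
open import Relation.Nullary using (Dec; yes; no; ¬_)
open import Relation.Nullary.Decidable using (⌊_⌋)

*≤⇒≤fl : ∀ {n x y} → 1 ≤ x → y * x ≤ n → y ≤ fl n x
*≤⇒≤fl {n} {suc x} {y} _ yx≤n =
  ℕ.≤-trans (ℕ.≤-reflexive (sym (m*n/n≡m y (suc x)))) (/-monoˡ-≤ (suc x) yx≤n)

≤fl⇒*≤ : ∀ {n x y} → 1 ≤ x → y ≤ fl n x → y * x ≤ n
≤fl⇒*≤ {n} {suc x} _ y≤fl = ℕ.≤-trans (ℕ.*-monoˡ-≤ (suc x) y≤fl) (m/n*n≤m n (suc x))

fl-antimono : ∀ {n x y} → 1 ≤ x → x ≤ y → fl n y ≤ fl n x
fl-antimono {n} {suc x} {suc y} _ x≤y = /-monoʳ-≤ n x≤y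

fl-≤ : ∀ n x → fl n x ≤ n
fl-≤ n zero    = z≤n
fl-≤ n (suc x) = m/n≤m n (suc x)

fl-pos : ∀ {n x} → 1 ≤ x → x ≤ n → 1 ≤ fl n x
fl-pos {x = x} 1≤x x≤n = *≤⇒≤fl 1≤x (subst (_≤ _) (sym (ℕ.*-identityˡ x)) x≤n)

≤-fl-fl : ∀ {n x} → 1 ≤ x → x ≤ n → x ≤ fl n (fl n x)
≤-fl-fl {n} {x} 1≤x x≤n =
  *≤⇒≤fl (fl-pos 1≤x x≤n) (subst (_≤ n) (ℕ.*-comm (fl n x) x) (≤fl⇒*≤ 1≤x ℕ.≤-refl))

*≤-resp-R : ∀ {n x x′ y} → 1 ≤ x → 1 ≤ x′ → R n x x′ → y * x ≤ n → y * x′ ≤ n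
*≤-resp-R {y = y} 1≤x 1≤x′ x~x′ yx≤n = ≤fl⇒*≤ 1≤x′ (subst (y ≤_) x~x′ (*≤⇒≤fl 1≤x yx≤n))

largestIn-≤ : ∀ n m k → largestIn n m k ≤ k
largestIn-≤ n m zero = z≤n
largestIn-≤ n m (suc k) with fl n (suc k) ≟ fl n m
... | yes _ = ℕ.≤-refl
... | no  _ = ℕ.m≤n⇒m≤1+n (largestIn-≤ n m k)

largestIn-R : ∀ n m k → 1 ≤ largestIn n m k → R n (largestIn n m k) m
largestIn-R n m zero    ()
largestIn-R n m (suc k) 1≤l with fl n (suc k) ≟ fl n m
... | yes k~m = k~m
... | no  _   = largestIn-R n m k 1≤l

largestIn-maximal : ∀ n m k {j} → 1 ≤ j → j ≤ k → R n j m → j ≤ largestIn n m k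
largestIn-maximal n m zero    1≤j j≤0 _ = ⊥-elim (ℕ.<⇒≱ 1≤j j≤0)
largestIn-maximal n m (suc k) 1≤j j≤k j~m with fl n (suc k) ≟ fl n m
... | yes _ = j≤k
... | no k≁m with ℕ.m≤n⇒m<n∨m≡n j≤k
...   | inj₁ j<k  = largestIn-maximal n m k 1≤j (ℕ.≤-pred j<k) j~m
...   | inj₂ refl = ⊥-elim (k≁m j~m)

≤-largest : ∀ {n m} → 1 ≤ m → m ≤ n → m ≤ largest n m
≤-largest {n} {m} 1≤m m≤n = largestIn-maximal n m n 1≤m m≤n refl

largest-R : ∀ {n m} → 1 ≤ m → m ≤ n → R n (largest n m) m
largest-R {n} {m} 1≤m m≤n = largestIn-R n m n (ℕ.≤-trans 1≤m (≤-largest 1≤m m≤n))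

record IsLargest (n k : ℕ) : Set where
  field
    pos   : 1 ≤ k
    ≤n    : k ≤ n
    fixed : largest n k ≡ k

largest-isLargest : ∀ {n m} → 1 ≤ m → m ≤ n → IsLargest n (largest n m)
largest-isLargest {n} {m} 1≤m m≤n = record
  { pos = 1≤l ; ≤n = l≤n ; fixed = ℕ.≤-antisym l′≤l (≤-largest 1≤l l≤n) }
  where
  l = largest n m
  1≤l = ℕ.≤-trans 1≤m (≤-largest 1≤m m≤n)
  l≤n = largestIn-≤ n m n
  l′≤l : largest n l ≤ l
  l′≤l = largestIn-maximal n m n (ℕ.≤-trans 1≤l (≤-largest 1≤l l≤n)) (largestIn-≤ n l n)
           (trans (largest-R 1≤l l≤n) (largest-R 1≤m m≤n))

fl-isLargest : ∀ {n x} → 1 ≤ x → x ≤ n → IsLargest n (fl n x)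
fl-isLargest {n} {x} 1≤x x≤n = record
  { pos = 1≤v ; ≤n = fl-≤ n x ; fixed = ℕ.≤-antisym l≤v (≤-largest 1≤v (fl-≤ n x)) }
  where
  v = fl n x
  1≤v = fl-pos 1≤x x≤n
  l = largest n v
  x≤fl-l : x ≤ fl n l
  x≤fl-l = subst (x ≤_) (sym (largest-R 1≤v (fl-≤ n x))) (≤-fl-fl 1≤x x≤n)
  l≤v : l ≤ v
  l≤v = *≤⇒≤fl 1≤x (subst (_≤ n) (ℕ.*-comm x l)
          (≤fl⇒*≤ (ℕ.≤-trans 1≤v (≤-largest 1≤v (fl-≤ n x))) x≤fl-l))

fl-strictAntimono : ∀ {n x y} → IsLargest n x → y ≤ n → x < y → fl n y < fl n x
fl-strictAntimono {n} {x} {y} x∈ y≤n x<y =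
  ℕ.≤∧≢⇒< (fl-antimono (IsLargest.pos x∈) (ℕ.<⇒≤ x<y)) fl-y≢fl-x
  where
  fl-y≢fl-x : fl n y ≢ fl n x
  fl-y≢fl-x y~x = ℕ.<⇒≱ x<y (subst (y ≤_) (IsLargest.fixed x∈)
    (largestIn-maximal n x n (ℕ.≤-trans (IsLargest.pos x∈) (ℕ.<⇒≤ x<y)) y≤n y~x))

∈𝒮⇒isLargest : ∀ {n k} → k ∈ 𝒮 n → IsLargest n k
∈𝒮⇒isLargest {n} k∈𝒮 with ∈-filter⁻ (λ k → largest n k ≟ k) {xs = map suc (upTo n)} k∈𝒮
... | k∈ , fixed with ∈-map⁻ suc k∈
...   | _ , j∈ , refl = record { pos = s≤s z≤n ; ≤n = ∈-upTo⁻ j∈ ; fixed = fixed }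

isLargest⇒∈𝒮 : ∀ {n k} → IsLargest n k → k ∈ 𝒮 n
isLargest⇒∈𝒮 {n} {suc k} k∈ =
  ∈-filter⁺ (λ k → largest n k ≟ k) (∈-map⁺ suc (∈-upTo⁺ (IsLargest.≤n k∈))) (IsLargest.fixed k∈)

𝒮-strictlySorted : ∀ n → AllPairs _<_ (𝒮 n)
𝒮-strictlySorted n =
  AllPairs.filter⁺ _ (AllPairs.map⁺ (AllPairs.applyUpTo⁺₁ id n (λ i<j _ → s≤s i<j)))

AllPairs-lookup : ∀ {a r} {A : Set a} {_∼_ : Rel A r} {xs : List A} → AllPairs _∼_ xs →
                  ∀ {i j} → i Fin.< j → lookup xs i ∼ lookup xs j
AllPairs-lookup (x∼xs ∷ _)   {zero}  {suc j} _         = All.lookup x∼xs (∈-lookup j)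
AllPairs-lookup (_ ∷ xs-ok) {suc i} {suc j} (s≤s i<j) = AllPairs-lookup xs-ok i<j

module _ (n : ℕ) where

  sₚ-isLargest : ∀ i → IsLargest n (sₚ n i)
  sₚ-isLargest i = ∈𝒮⇒isLargest (∈-lookup i)

  sₚ-strictMono : ∀ {i j} → i Fin.< j → sₚ n i < sₚ n j
  sₚ-strictMono = AllPairs-lookup (𝒮-strictlySorted n)

  sₚ-mono : ∀ {i j} → i Fin.≤ j → sₚ n i ≤ sₚ n j
  sₚ-mono {i} {j} i≤j with i Fin.≟ j
  ... | yes refl = ℕ.≤-refl
  ... | no  i≢j  = ℕ.<⇒≤ (sₚ-strictMono (Fin.≤∧≢⇒< i≤j i≢j))

  sₚ-cancel-≤ : ∀ {i j} → sₚ n i ≤ sₚ n j → i Fin.≤ j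
  sₚ-cancel-≤ sᵢ≤sⱼ = ℕ.≮⇒≥ (λ j<i → ℕ.<⇒≱ (sₚ-strictMono j<i) sᵢ≤sⱼ)

  sₚ-cancel-< : ∀ {i j} → sₚ n i < sₚ n j → i Fin.< j
  sₚ-cancel-< sᵢ<sⱼ = ℕ.≰⇒> (λ j≤i → ℕ.<⇒≱ sᵢ<sⱼ (sₚ-mono j≤i))

  sₚ-injective : ∀ {i j} → sₚ n i ≡ sₚ n j → i ≡ j
  sₚ-injective sᵢ≡sⱼ =
    Fin.≤-antisym (sₚ-cancel-≤ (ℕ.≤-reflexive sᵢ≡sⱼ)) (sₚ-cancel-≤ (ℕ.≤-reflexive (sym sᵢ≡sⱼ)))

  indexOf : ∀ {k} → IsLargest n k → Fin (s n)
  indexOf k∈ = index (isLargest⇒∈𝒮 k∈)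

  sₚ-indexOf : ∀ {k} (k∈ : IsLargest n k) → sₚ n (indexOf k∈) ≡ k
  sₚ-indexOf k∈ = sym (lookup-index (isLargest⇒∈𝒮 k∈))

antitone-gap : ∀ {m} (σ : Fin m → Fin m) → σ Preserves Fin._<_ ⟶ Fin._>_ →
               ∀ d {i j} → toℕ j ≡ d + toℕ i → d + toℕ (σ j) ≤ toℕ (σ i)
antitone-gap σ σ-anti zero    {i} {j} j≡i rewrite Fin.toℕ-injective {i = j} {j = i} j≡i = ℕ.≤-refl
antitone-gap {m} σ σ-anti (suc d) {i} {j} j≡ = begin
  suc (d + toℕ (σ j))  ≡⟨ ℕ.+-suc d _ ⟨
  d + suc (toℕ (σ j))  ≤⟨ ℕ.+-monoʳ-≤ d (σ-anti j′<j) ⟩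
  d + toℕ (σ j′)       ≤⟨ antitone-gap σ σ-anti d (Fin.toℕ-fromℕ< d+i<m) ⟩
  toℕ (σ i)            ∎
  where
  open ℕ.≤-Reasoning
  d+i<m : d + toℕ i < m
  d+i<m = ℕ.<-trans (ℕ.n<1+n _) (subst (_< m) j≡ (Fin.toℕ<n j))
  j′ = fromℕ< d+i<m
  j′<j : j′ Fin.< j
  j′<j = subst₂ _<_ (sym (Fin.toℕ-fromℕ< d+i<m)) (sym j≡) (ℕ.n<1+n _)

antitone-reverses : ∀ {m} (σ : Fin m → Fin m) → σ Preserves Fin._<_ ⟶ Fin._>_ →
                    ∀ p → suc (toℕ p + toℕ (σ p)) ≡ m
antitone-reverses {suc m} σ σ-anti p = cong suc (ℕ.≤-antisym upper lower)
  where
  p≤m : toℕ p ≤ m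
  p≤m = ℕ.≤-pred (Fin.toℕ<n p)
  upper : toℕ p + toℕ (σ p) ≤ m
  upper = ℕ.≤-trans (antitone-gap σ σ-anti (toℕ p) (sym (ℕ.+-identityʳ _)))
                    (ℕ.≤-pred (Fin.toℕ<n (σ zero)))
  gap : m ∸ toℕ p ≤ toℕ (σ p)
  gap = ℕ.≤-trans (ℕ.m≤m+n _ _)
          (antitone-gap σ σ-anti (m ∸ toℕ p) (trans (Fin.toℕ-fromℕ m) (sym (ℕ.m∸n+n≡m p≤m))))
  lower : m ≤ toℕ p + toℕ (σ p)
  lower = subst (_≤ toℕ p + toℕ (σ p)) (ℕ.m+[n∸m]≡n p≤m) (ℕ.+-monoʳ-≤ (toℕ p) gap)

module _ (n : ℕ) where

  dual : Fin (s n) → Fin (s n)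
  dual p = indexOf n (fl-isLargest (IsLargest.pos sₚ∈) (IsLargest.≤n sₚ∈))
    where sₚ∈ = sₚ-isLargest n p

  sₚ-dual : ∀ p → sₚ n (dual p) ≡ fl n (sₚ n p)
  sₚ-dual p = sₚ-indexOf n _

  dual-antitone : dual Preserves Fin._<_ ⟶ Fin._>_
  dual-antitone {i} {j} i<j = sₚ-cancel-< n (subst₂ _<_ (sym (sₚ-dual j)) (sym (sₚ-dual i))
    (fl-strictAntimono (sₚ-isLargest n i) (IsLargest.≤n (sₚ-isLargest n j)) (sₚ-strictMono n i<j)))

𝟙 : ∀ {P : Set} → Dec P → ℤ
𝟙 P? = if ⌊ P? ⌋ then 1ℤ else 0ℤ

if-yes : ∀ {A P : Set} {x y : A} (P? : Dec P) → P → (if ⌊ P? ⌋ then x else y) ≡ x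
if-yes (yes _) _  = refl
if-yes (no ¬p) p = ⊥-elim (¬p p)

if-no : ∀ {A P : Set} {x y : A} (P? : Dec P) → ¬ P → (if ⌊ P? ⌋ then x else y) ≡ y
if-no (yes p) ¬p = ⊥-elim (¬p p)
if-no (no _)  _  = refl

𝟙-cong : ∀ {P Q : Set} (P? : Dec P) (Q? : Dec Q) → P ⇔ Q → 𝟙 P? ≡ 𝟙 Q?
𝟙-cong (yes p) Q?     P⇔Q = sym (if-yes Q? (Equivalence.to P⇔Q p))
𝟙-cong (no ¬p) (yes q) P⇔Q = ⊥-elim (¬p (Equivalence.from P⇔Q q))
𝟙-cong (no _)  (no _)  _   = refl

suc+suc≤⇔≤ : ∀ {p t d s} → suc (p + d) ≡ s → suc p + suc t ≤ suc s ⇔ t ≤ d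
suc+suc≤⇔≤ {p} {t} {d} refl = mk⇔
  (λ { (s≤s h) → ℕ.+-cancelˡ-≤ p t d (ℕ.≤-pred (subst (_≤ suc (p + d)) (ℕ.+-suc p t) h)) })
  (λ t≤d → s≤s (subst (_≤ suc (p + d)) (sym (ℕ.+-suc p t)) (s≤s (ℕ.+-monoʳ-≤ p t≤d))))

T-≡-𝟙 : ∀ n p t → T n p t ≡ 𝟙 (sₚ n p * sₚ n t ≤? n)
T-≡-𝟙 n p t = 𝟙-cong _ _ (begin
  suc (toℕ p) + suc (toℕ t) ≤ suc (s n)
    ≈⟨ suc+suc≤⇔≤ (antitone-reverses (dual n) (dual-antitone n) p) ⟩
  t Fin.≤ dual n p                        ≈⟨ mk⇔ (sₚ-mono n) (sₚ-cancel-≤ n) ⟩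
  sₚ n t ≤ sₚ n (dual n p)                ≡⟨ cong (sₚ n t ≤_) (sₚ-dual n p) ⟩
  sₚ n t ≤ fl n (sₚ n p)                  ≈⟨ mk⇔ (≤fl⇒*≤ 1≤sₚ) (*≤⇒≤fl 1≤sₚ) ⟩
  sₚ n t * sₚ n p ≤ n                     ≡⟨ cong (_≤ n) (ℕ.*-comm (sₚ n t) (sₚ n p)) ⟩
  sₚ n p * sₚ n t ≤ n                     ∎)
  where
  open import Relation.Binary.Reasoning.Setoid (⇔-setoid _)
  1≤sₚ = IsLargest.pos (sₚ-isLargest n p)

sumFin≡sum : ∀ m (f : Fin m → ℤ) → sumFin m f ≡ sum f
sumFin≡sum zero    f = refl
sumFin≡sum (suc m) f = cong (f zero +ℤ_) (sumFin≡sum m (f ∘ suc))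

sum-zero : ∀ {m} {f : Fin m → ℤ} → (∀ i → f i ≡ 0ℤ) → sum f ≡ 0ℤ
sum-zero {m} f≡0 = trans (sum-cong-≗ f≡0) (sum-replicate-zero m)

sum-pick : ∀ {m} (f e : Fin m → ℤ) {q} → e q ≡ 1ℤ → (∀ i → i ≢ q → e i ≡ 0ℤ) →
           sum (λ i → f i *ℤ e i) ≡ f q
sum-pick {suc m} f e {zero} e-q e-rest = begin
  f zero *ℤ e zero +ℤ rest
    ≡⟨ cong (_+ℤ rest) (trans (cong (f zero *ℤ_) e-q) (ℤ.*-identityʳ (f zero))) ⟩
  f zero +ℤ rest
    ≡⟨ cong (f zero +ℤ_) (sum-zero (λ i →
         trans (cong (f (suc i) *ℤ_) (e-rest (suc i) λ ())) (ℤ.*-zeroʳ (f (suc i))))) ⟩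
  f zero +ℤ 0ℤ
    ≡⟨ ℤ.+-identityʳ (f zero) ⟩
  f zero ∎
  where
  open ≡-Reasoning
  rest = sum (λ i → f (suc i) *ℤ e (suc i))
sum-pick {suc m} f e {suc q} e-q e-rest = begin
  f zero *ℤ e zero +ℤ rest
    ≡⟨ cong (_+ℤ rest) (trans (cong (f zero *ℤ_) (e-rest zero λ ())) (ℤ.*-zeroʳ (f zero))) ⟩
  0ℤ +ℤ rest
    ≡⟨ ℤ.+-identityˡ _ ⟩
  rest
    ≡⟨ sum-pick (f ∘ suc) (e ∘ suc) e-q (λ i i≢q → e-rest (suc i) (i≢q ∘ Fin.suc-injective)) ⟩
  f (suc q) ∎
  where
  open ≡-Reasoning
  rest = sum (λ i → f (suc i) *ℤ e (suc i))

ρ-column : ∀ n a r q → ρ n a r q ≡ sum (λ i → a i *ℤ basisMul n i q r)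
ρ-column n a r q = begin
  ρ n a r q
    ≡⟨ sumFin≡sum (s n) _ ⟩
  sum (λ i → sumFin (s n) (λ j → (a i *ℤ basis n q j) *ℤ basisMul n i j r))
    ≡⟨ sum-cong-≗ (λ i → sumFin≡sum (s n) (λ j → (a i *ℤ basis n q j) *ℤ basisMul n i j r)) ⟩
  sum (λ i → sum (λ j → (a i *ℤ basis n q j) *ℤ basisMul n i j r))
    ≡⟨ sum-cong-≗ (λ i → sum-cong-≗ (λ j → xy*z≡xz*y (a i) (basis n q j) (basisMul n i j r))) ⟩
  sum (λ i → sum (λ j → (a i *ℤ basisMul n i j r) *ℤ basis n q j))
    ≡⟨ sum-cong-≗ (λ i → sum-pick (λ j → a i *ℤ basisMul n i j r) (basis n q)
                     (if-yes (toℕ q ≟ toℕ q) refl)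
                     (λ j j≢q → if-no (toℕ j ≟ toℕ q) (j≢q ∘ Fin.toℕ-injective))) ⟩
  sum (λ i → a i *ℤ basisMul n i q r) ∎
  where open ≡-Reasoning

T-largest : ∀ n p {m} → 1 ≤ m → m ≤ n →
            sum (λ r → T n p r *ℤ 𝟙 (sₚ n r ≟ largest n m)) ≡ 𝟙 (sₚ n p * m ≤? n)
T-largest n p {m} 1≤m m≤n = begin
  sum (λ r → T n p r *ℤ 𝟙 (sₚ n r ≟ largest n m))
    ≡⟨ sum-pick (T n p) (λ r → 𝟙 (sₚ n r ≟ l)) (if-yes (sₚ n t ≟ l) (sₚ-indexOf n l∈))
                (λ r r≢t → if-no (sₚ n r ≟ l)
                                 (r≢t ∘ sₚ-injective n ∘ (λ e → trans e (sym (sₚ-indexOf n l∈))))) ⟩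
  T n p t
    ≡⟨ T-≡-𝟙 n p t ⟩
  𝟙 (sₚ n p * sₚ n t ≤? n)
    ≡⟨ 𝟙-cong (sₚ n p * sₚ n t ≤? n) (sₚ n p * m ≤? n)
              (mk⇔ (*≤-resp-R {y = sₚ n p} 1≤sₜ 1≤m t~m) (*≤-resp-R {y = sₚ n p} 1≤m 1≤sₜ (sym t~m))) ⟩
  𝟙 (sₚ n p * m ≤? n) ∎
  where
  open ≡-Reasoning
  l = largest n m
  l∈ = largest-isLargest 1≤m m≤n
  t = indexOf n l∈
  1≤sₜ = IsLargest.pos (sₚ-isLargest n t)
  t~m : R n (sₚ n t) m
  t~m = trans (cong (fl n) (sₚ-indexOf n l∈)) (largest-R 1≤m m≤n)

T-basisMul : ∀ n p i q →
             sum (λ r → T n p r *ℤ basisMul n i q r) ≡ 𝟙 (sₚ n p * (sₚ n i * sₚ n q) ≤? n)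
T-basisMul n p i q = by-cases (m ≤? n)
  where
  open ≡-Reasoning
  m = sₚ n i * sₚ n q
  1≤sₚ : ∀ k → 1 ≤ sₚ n k
  1≤sₚ k = IsLargest.pos (sₚ-isLargest n k)
  by-cases : Dec (m ≤ n) → sum (λ r → T n p r *ℤ basisMul n i q r) ≡ 𝟙 (sₚ n p * m ≤? n)
  by-cases (yes m≤n) = begin
    sum (λ r → T n p r *ℤ basisMul n i q r)
      ≡⟨ sum-cong-≗ (λ r → cong (T n p r *ℤ_) (if-yes (m ≤? n) m≤n)) ⟩
    sum (λ r → T n p r *ℤ 𝟙 (sₚ n r ≟ largest n m))
      ≡⟨ T-largest n p (ℕ.*-mono-≤ (1≤sₚ i) (1≤sₚ q)) m≤n ⟩
    𝟙 (sₚ n p * m ≤? n) ∎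
  by-cases (no m≰n) = begin
    sum (λ r → T n p r *ℤ basisMul n i q r)
      ≡⟨ sum-zero (λ r → trans (cong (T n p r *ℤ_) (if-no (m ≤? n) m≰n)) (ℤ.*-zeroʳ (T n p r))) ⟩
    0ℤ
      ≡⟨ if-no (sₚ n p * m ≤? n) (m≰n ∘ ℕ.≤-trans (ℕ.m≤n*m m _ {{>-nonZero (1≤sₚ p)}})) ⟨
    𝟙 (sₚ n p * m ≤? n) ∎

Tρ-entry : ∀ n a p q →
           matMul n (T n) (ρ n a) p q ≡ sum (λ i → a i *ℤ 𝟙 (sₚ n p * (sₚ n i * sₚ n q) ≤? n))
Tρ-entry n a p q = begin
  matMul n (T n) (ρ n a) p q
    ≡⟨ sumFin≡sum (s n) _ ⟩
  sum (λ r → T n p r *ℤ ρ n a r q)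
    ≡⟨ sum-cong-≗ (λ r → trans (cong (T n p r *ℤ_) (ρ-column n a r q))
                               (*-distribˡ-sum (T n p r) (λ i → a i *ℤ basisMul n i q r))) ⟩
  sum (λ r → sum (λ i → T n p r *ℤ (a i *ℤ basisMul n i q r)))
    ≡⟨ ∑-comm (λ r i → T n p r *ℤ (a i *ℤ basisMul n i q r)) ⟩
  sum (λ i → sum (λ r → T n p r *ℤ (a i *ℤ basisMul n i q r)))
    ≡⟨ sum-cong-≗ (λ i → sum-cong-≗ (λ r → x*[y*z]≡y*[x*z] (T n p r) (a i) (basisMul n i q r))) ⟩
  sum (λ i → sum (λ r → a i *ℤ (T n p r *ℤ basisMul n i q r)))
    ≡⟨ sum-cong-≗ (λ i → *-distribˡ-sum (a i) (λ r → T n p r *ℤ basisMul n i q r)) ⟨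
  sum (λ i → a i *ℤ sum (λ r → T n p r *ℤ basisMul n i q r))
    ≡⟨ sum-cong-≗ (λ i → cong (a i *ℤ_) (T-basisMul n p i q)) ⟩
  sum (λ i → a i *ℤ 𝟙 (sₚ n p * (sₚ n i * sₚ n q) ≤? n)) ∎
  where open ≡-Reasoning

proposition5 : (n : ℕ) → 1 ≤ n → (a : 𝓐 n) → Symmetric n (matMul n (T n) (ρ n a))
proposition5 n _ a p q = begin
  matMul n (T n) (ρ n a) p q
    ≡⟨ Tρ-entry n a p q ⟩
  sum (λ i → a i *ℤ 𝟙 (sₚ n p * (sₚ n i * sₚ n q) ≤? n))
    ≡⟨ sum-cong-≗ (λ i → cong (a i *ℤ_)
         (𝟙-cong _ _ (mk⇔ (subst (_≤ n) (swap i)) (subst (_≤ n) (sym (swap i)))))) ⟩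
  sum (λ i → a i *ℤ 𝟙 (sₚ n q * (sₚ n i * sₚ n p) ≤? n))
    ≡⟨ Tρ-entry n a q p ⟨
  matMul n (T n) (ρ n a) q p ∎
  where
  open ≡-Reasoning
  swap : ∀ i → sₚ n p * (sₚ n i * sₚ n q) ≡ sₚ n q * (sₚ n i * sₚ n p)
  swap i = x*[y*z]≡z*[y*x] (sₚ n p) (sₚ n i) (sₚ n q)
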